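{- Let $\ell\ge2$. For every partial multifunction $f\colon\subseteq\mathbb{N}\rightrightarrows\mathbb{N}$, $\mathtt{Error}_{1/\ell}\not\le_{LT}(f\mid\mathtt{Error}_{1/\ell+1})$.
   Context: A bilayer function is a partial multi-valued $g\colon\subseteq\mathbb{N}\times\Lambda\rightrightarrows\mathbb{N}$, arguments written $(n\mid c)$ ($n$ public, $c$ secret input), $\mathrm{dom}_{\rm pub}(g)=\{n:\exists c\,(n\mid c)\in\mathrm{dom}(g)\}$; a basic bilayer function is one whose public input is always $\ast$. For $m<k$, $\mathtt{Error}_{m/k}$ is the basic bilayer function with domain $\{(\ast\mid A):A\subseteq\{0,\dots,k-1\},|A|=m\}$ and value $\{0,\dots,k-1\}\setminus A$. For a partial multifunction $f$ and a basic bilayer function $g$, $(f\mid g)$ is the bilayer function $(f\mid g)(n\mid c)=f(n)\times g(\ast\mid c)$ (pairs coded as natural numbers), defined when $n\in\mathrm{dom}(f)$ and $(\ast\mid c)\in\mathrm{dom}(g)$. Game $\mathfrak{G}(F,G)$: Merlin first plays $(x_0\mid c_0)\in\mathrm{dom}(F)$; at round $n$ Arthur plays $\langle j,u_n\rangle$ ($j=0$: query $u_n\in\mathrm{dom}_{\rm pub}(G)$; $j=1$: terminate with output $u_n$); after a query Nimue plays $z_n$ with $(u_n\mid z_n)\in\mathrm{dom}(G)$ and Merlin plays $x_{n+1}\in G(u_n\mid z_n)$. Arthur sees only $x_0,x_1,\dots$ and plays a partial computable strategy; Merlin and Nimue see everything. Arthur–Nimue win if Merlin violates the rules first or both obey and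 Arthur terminates with $u_n\in F(x_0\mid c_0)$. $F\le_{LT}G$ iff a winning Arthur–Nimue strategy exists. -}

module Defs where

open import Data.Nat using (ℕ; zero; suc; _+_)
open import Data.Fin using (Fin; toℕ)
open import Data.Fin.Subset using (Subset; ∣_∣; _∉_)
open import Data.Vec using (Vec; []; _∷_; lookup)
open import Data.List using (List; []; _∷_; map; upTo)
open import Data.Product using (Σ; ∃; ∃₂; _×_; _,_)
open import Data.Sum using (_⊎_)
open import Relation.Nullary using (¬_)
open import Relation.Binary.PropositionalEquality using (_≡_)

tri : ℕ → ℕ
tri zero    = zero
tri (suc n) = suc n + tri n

pair : ℕ → ℕ → ℕ
pair a b = tri (a + b) + b

encode : List ℕ → ℕ
encode []       = 0
encode (a ∷ as) = suc (pair a (encode as))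

data PR : ℕ → Set where
  zer  : ∀ {n} → PR n
  succ : PR 1
  proj : ∀ {n} → Fin n → PR n
  comp : ∀ {m n} → PR m → Vec (PR n) m → PR n
  prec : ∀ {n} → PR n → PR (suc (suc n)) → PR (suc n)
  mu   : ∀ {n} → PR (suc n) → PR n

mutual
  data _[_]⇓_ : ∀ {n} → PR n → Vec ℕ n → ℕ → Set where
    ev-zer   : ∀ {n} {xs : Vec ℕ n} → zer [ xs ]⇓ 0
    ev-succ  : ∀ {x} → succ [ x ∷ [] ]⇓ suc x
    ev-proj  : ∀ {n} {i : Fin n} {xs : Vec ℕ n} → proj i [ xs ]⇓ lookup xs i
    ev-comp  : ∀ {m n} {g : PR m} {hs : Vec (PR n) m} {xs : Vec ℕ n} {ys : Vec ℕ m} {y} →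
               hs [ xs ]⇓* ys → g [ ys ]⇓ y → comp g hs [ xs ]⇓ y
    ev-prec0 : ∀ {n} {g : PR n} {h : PR (suc (suc n))} {xs : Vec ℕ n} {y} →
               g [ xs ]⇓ y → prec g h [ 0 ∷ xs ]⇓ y
    ev-precS : ∀ {n} {g : PR n} {h : PR (suc (suc n))} {xs : Vec ℕ n} {k r y} →
               prec g h [ k ∷ xs ]⇓ r → h [ k ∷ r ∷ xs ]⇓ y → prec g h [ suc k ∷ xs ]⇓ y
    ev-mu    : ∀ {n} {f : PR (suc n)} {xs : Vec ℕ n} {y} →
               MuFrom f xs 0 y → mu f [ xs ]⇓ y

  data _[_]⇓*_ : ∀ {m n} → Vec (PR n) m → Vec ℕ n → Vec ℕ m → Set where
    []  : ∀ {n} {xs : Vec ℕ n} → [] [ xs ]⇓* []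
    _∷_ : ∀ {m n} {h : PR n} {hs : Vec (PR n) m} {xs : Vec ℕ n} {y ys} →
          h [ xs ]⇓ y → hs [ xs ]⇓* ys → (h ∷ hs) [ xs ]⇓* (y ∷ ys)

  data MuFrom {n} (f : PR (suc n)) (xs : Vec ℕ n) : ℕ → ℕ → Set where
    here  : ∀ {k} → f [ k ∷ xs ]⇓ 0 → MuFrom f xs k k
    there : ∀ {k v y} → f [ k ∷ xs ]⇓ suc v → MuFrom f xs (suc k) y → MuFrom f xs k y

-- Bilayer functions  g :⊆ ℕ × Λ ⇉ ℕ ,  arguments (n ∣ c)

record Bilayer (Λ : Set) : Set₁ where
  field
    dom : ℕ → Λ → Set
    val : ℕ → Λ → ℕ → Set
open Bilayer public

dom-pub : ∀ {Λ} → Bilayer Λ → ℕ → Set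
dom-pub {Λ} g n = Σ Λ λ c → dom g n c

-- the public input ∗ of basic bilayer functions is coded as 0
star : ℕ
star = 0

Error : (m k : ℕ) → Bilayer (Subset k)
Error m k = record
  { dom = λ n A → n ≡ star × ∣ A ∣ ≡ m
  ; val = λ n A y → Σ (Fin k) λ i → toℕ i ≡ y × i ∉ A
  }

-- A partial multifunction f :⊆ ℕ ⇉ ℕ is given by its graph (f n y ⇔ y ∈ f(n));
-- dom(f) = { n | f(n) ≠ ∅ }.
PMF : Set₁
PMF = ℕ → ℕ → Set

domPMF : PMF → ℕ → Set
domPMF f n = ∃ λ y → f n y

_∣ᵇ_ : ∀ {Λ} → PMF → Bilayer Λ → Bilayer Λ
f ∣ᵇ g = record
  { dom = λ n c → domPMF f n × dom g star c
  ; val = λ n c y → ∃₂ λ a b → y ≡ pair a b × f n a × val g star c b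
  }

-- Arthur: a partial computable strategy A (μ-recursive program), applied to
--   the code of the sequence x₀,…,x_k of Merlin's moves seen so far; its move
--   ⟨j,u⟩ is pair j u (j = 0 query, j = 1 terminate; anything else is illegal).
-- Nimue: sees everything; since all other moves are determined by
--   c₀ and Merlin's moves x₀,…,x_k, her strategy is N c₀ (x₀ ∷ … ∷ x_k).
-- Merlin: plays against deterministic opponents, so it suffices to quantify
--   over all his move sequences c₀, x : ℕ → ℕ.

module Game {Λ₁ Λ₂ : Set} (F : Bilayer Λ₁) (G : Bilayer Λ₂)
            (A : PR 1) (N : Λ₁ → List ℕ → Λ₂) (c₀ : Λ₁) (x : ℕ → ℕ) where

  hist : ℕ → List ℕ
  hist k = map x (upTo (suc k))

  data WinFrom (k : ℕ) : Set where
    terminate : ∀ u → A [ encode (hist k) ∷ [] ]⇓ pair 1 u →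
                val F (x 0) c₀ u → WinFrom k
    query     : ∀ u → A [ encode (hist k) ∷ [] ]⇓ pair 0 u →
                dom-pub G u →
                dom G u (N c₀ (hist k)) →
                (¬ val G u (N c₀ (hist k)) (x (suc k)) ⊎ WinFrom (suc k)) →
                WinFrom k

  Win : Set
  Win = ¬ dom F (x 0) c₀ ⊎ WinFrom 0

_≤LT_ : ∀ {Λ₁ Λ₂ : Set} → Bilayer Λ₁ → Bilayer Λ₂ → Set
_≤LT_ {Λ₁} {Λ₂} F G =
  Σ (PR 1) λ A → Σ (Λ₁ → List ℕ → Λ₂) λ N →
    ∀ (c₀ : Λ₁) (x : ℕ → ℕ) → Game.Win F G A N c₀ x

module Submission where

-- Merlin answers so that Arthur's view never depends on the secret. Against
-- each singleton secret ⁅ i ⁆ Nimue holds some secret of size 1 in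
-- {0,…,ℓ}; the ℓ of them miss a common b, so after any query u Merlin can
-- reply ⟨a , b⟩ with a ∈ f(u), legally in all ℓ plays at once.  Arthur is
-- deterministic, so along such a play he makes the same moves for every i;
-- he cannot terminate, because an answer u would have to lie outside ⁅ u ⁆.
-- Extending such plays round by round yields one infinite play on which
-- Arthur never wins.

open import Defs
open import Data.Nat using (ℕ; zero; suc; _+_; _≤_; _<_; z≤n; s≤s)
open import Data.Nat.Properties
open import Data.Fin using (Fin; toℕ) renaming (zero to fzero; suc to fsuc)
import Data.Fin.Properties as Fin
open import Data.Fin.Subset using (Subset; ∣_∣; _∉_; _∈_; ⁅_⁆; inside; outside)
open import Data.Fin.Subset.Properties using (_∈?_; x∈⁅x⁆; ∣⁅x⁆∣≡1)
open import Data.Vec using (Vec; _∷_; []; here; there)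
open import Data.List using (List; map; upTo)
open import Data.List.Properties using (map-cong-local)
open import Data.List.Relation.Unary.All using (tabulate)
open import Data.List.Membership.Propositional.Properties using (∈-upTo⁻)
open import Data.Product using (∃; _×_; _,_; proj₁; proj₂)
open import Data.Sum using (inj₁; inj₂)
open import Data.Empty using (⊥-elim)
open import Relation.Nullary using (¬_; yes; no; ¬?; contradiction)
open import Relation.Nullary.Decidable using (decidable-stable)
open import Relation.Binary.PropositionalEquality
open import Function using (_∘_)
open import Relation.Binary.Definitions using (tri<; tri≈; tri>)
open Game using (WinFrom; terminate; query)

mutual
  ⇓-deterministic : ∀ {n} {e : PR n} {xs y y′} → e [ xs ]⇓ y → e [ xs ]⇓ y′ → y ≡ y′
  ⇓-deterministic ev-zer ev-zer = refl
  ⇓-deterministic ev-succ ev-succ = refl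
  ⇓-deterministic ev-proj ev-proj = refl
  ⇓-deterministic (ev-comp hs g) (ev-comp hs′ g′)
    rewrite ⇓*-deterministic hs hs′ = ⇓-deterministic g g′
  ⇓-deterministic (ev-prec0 g) (ev-prec0 g′) = ⇓-deterministic g g′
  ⇓-deterministic (ev-precS p h) (ev-precS p′ h′)
    rewrite ⇓-deterministic p p′ = ⇓-deterministic h h′
  ⇓-deterministic (ev-mu s) (ev-mu s′) = MuFrom-deterministic s s′

  ⇓*-deterministic : ∀ {m n} {hs : Vec (PR n) m} {xs ys ys′} →
                     hs [ xs ]⇓* ys → hs [ xs ]⇓* ys′ → ys ≡ ys′
  ⇓*-deterministic [] [] = refl
  ⇓*-deterministic (h ∷ hs) (h′ ∷ hs′) =
    cong₂ _∷_ (⇓-deterministic h h′) (⇓*-deterministic hs hs′)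

  MuFrom-deterministic : ∀ {n} {f : PR (suc n)} {xs k y y′} →
                         MuFrom f xs k y → MuFrom f xs k y′ → y ≡ y′
  MuFrom-deterministic (here _) (here _) = refl
  MuFrom-deterministic (here z) (there s _) with () ← ⇓-deterministic z s
  MuFrom-deterministic (there s _) (here z) with () ← ⇓-deterministic s z
  MuFrom-deterministic (there _ m) (there _ m′) = MuFrom-deterministic m m′

tri-mono-≤ : ∀ {s t} → s ≤ t → tri s ≤ tri t
tri-mono-≤ {zero} _ = z≤n
tri-mono-≤ {suc s} {suc t} (s≤s s≤t) = +-mono-≤ (s≤s s≤t) (tri-mono-≤ s≤t)

pair<tri[1+a+b] : ∀ a b → pair a b < tri (suc (a + b))
pair<tri[1+a+b] a b = begin-strict
  tri (a + b) + b           <⟨ +-monoʳ-< (tri (a + b)) (s≤s (m≤n+m b a)) ⟩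
  tri (a + b) + suc (a + b) ≡⟨ +-comm (tri (a + b)) _ ⟩
  tri (suc (a + b))         ∎
  where open ≤-Reasoning

pair-mono-< : ∀ a b c d → a + b < c + d → pair a b < pair c d
pair-mono-< a b c d lt =
  <-≤-trans (pair<tri[1+a+b] a b) (≤-trans (tri-mono-≤ lt) (m≤m+n (tri (c + d)) d))

pair-injective : ∀ {a b c d} → pair a b ≡ pair c d → a ≡ c × b ≡ d
pair-injective {a} {b} {c} {d} eq with <-cmp (a + b) (c + d)
... | tri< lt _ _ = contradiction eq (<⇒≢ (pair-mono-< a b c d lt))
... | tri> _ _ gt = contradiction (sym eq) (<⇒≢ (pair-mono-< c d a b gt))
... | tri≈ _ a+b≡c+d _ = a≡c , b≡d
  where
  b≡d : b ≡ d
  b≡d = +-cancelˡ-≡ (tri (a + b)) b d (trans eq (cong (λ s → tri s + d) (sym a+b≡c+d)))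
  a≡c : a ≡ c
  a≡c = +-cancelʳ-≡ b a c (trans a+b≡c+d (cong (c +_) (sym b≡d)))

∣p∣≡0⇒∉ : ∀ {n} {p : Subset n} {x} → ∣ p ∣ ≡ 0 → x ∉ p
∣p∣≡0⇒∉ {p = outside ∷ p} e (there x∈p) = ∣p∣≡0⇒∉ {p = p} e x∈p

∣p∣≡1⇒∈-unique : ∀ {n} {p : Subset n} {x y} → ∣ p ∣ ≡ 1 → x ∈ p → y ∈ p → x ≡ y
∣p∣≡1⇒∈-unique {p = inside ∷ p} _ here here = refl
∣p∣≡1⇒∈-unique {p = inside ∷ p} e here (there y∈p) = ⊥-elim (∣p∣≡0⇒∉ {p = p} (suc-injective e) y∈p)
∣p∣≡1⇒∈-unique {p = inside ∷ p} e (there x∈p) _ = ⊥-elim (∣p∣≡0⇒∉ {p = p} (suc-injective e) x∈p)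
∣p∣≡1⇒∈-unique {p = outside ∷ p} e (there x∈p) (there y∈p) =
  cong fsuc (∣p∣≡1⇒∈-unique {p = p} e x∈p y∈p)

¬∃∉⇒∃∈ : ∀ {n m} (P : Fin n → Subset m) → ¬ (∃ λ b → ∀ i → b ∉ P i) → ∀ b → ∃ λ i → b ∈ P i
¬∃∉⇒∃∈ {n} P none b
  with i , ¬b∉Pi ← Fin.¬∀⟶∃¬ n (λ i → b ∉ P i) (λ i → ¬? (b ∈? P i)) (λ b∉P → none (b , b∉P))
  = i , decidable-stable (b ∈? P i) ¬b∉Pi

-- If no b were free, sending each b to some i with b ∈ P i would map
-- Fin (suc n) injectively into Fin n.
∃-∉-singletons : ∀ n (P : Fin n → Subset (suc n)) → (∀ i → ∣ P i ∣ ≡ 1) →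
                 ∃ λ b → ∀ i → b ∉ P i
∃-∉-singletons n P one with Fin.any? (λ b → Fin.all? (λ i → ¬? (b ∈? P i)))
... | yes found = found
... | no none
  with b , b′ , b<b′ , same-owner ← Fin.pigeonhole (n<1+n n) (proj₁ ∘ ¬∃∉⇒∃∈ P none)
  = contradiction (∣p∣≡1⇒∈-unique (one _) (proj₂ (¬∃∉⇒∃∈ P none b))
                    (subst (λ i → b′ ∈ P i) (sym same-owner) (proj₂ (¬∃∉⇒∃∈ P none b′))))
                  (Fin.<⇒≢ b<b′)

AgreeUpTo : ℕ → (ℕ → ℕ) → (ℕ → ℕ) → Set
AgreeUpTo k x y = ∀ t → t ≤ k → x t ≡ y t

history : (ℕ → ℕ) → ℕ → List ℕ
history x k = map x (upTo (suc k))

history-cong : ∀ {k x y} → AgreeUpTo k x y → history x k ≡ history y k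
history-cong agree = map-cong-local (tabulate (λ t∈ → agree _ (≤-pred (∈-upTo⁻ t∈))))

followedBy : (ℕ → ℕ) → ℕ → ℕ → ℕ → ℕ
followedBy x k v j with j ≤? k
... | yes _ = x j
... | no _  = v

followedBy-agrees : ∀ x k v → AgreeUpTo k (followedBy x k v) x
followedBy-agrees x k v j j≤k with j ≤? k
... | yes _ = refl
... | no j≰k = contradiction j≤k j≰k

followedBy-suc : ∀ x k v → followedBy x k v (suc k) ≡ v
followedBy-suc x k v with suc k ≤? k
... | yes 1+k≤k = contradiction 1+k≤k 1+n≰n
... | no _ = refl

module _ (P : ℕ → (ℕ → ℕ) → Set) (P-cong : ∀ {k x y} → AgreeUpTo k x y → P k x → P k y) where

  prefix-limit : ∃ (P 0) → (∀ {k x} → P k x → ∃ λ x′ → P (suc k) x′ × AgreeUpTo k x′ x) →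
                 ∃ λ X → ∀ k → P k X
  prefix-limit (x₀ , p₀) extend = X , λ k → P-cong (approx-agrees k) (proj₂ (approx k))
    where
    approx : ∀ k → ∃ (P k)
    approx zero = x₀ , p₀
    approx (suc k) = proj₁ (extend (proj₂ (approx k))) , proj₁ (proj₂ (extend (proj₂ (approx k))))
    X : ℕ → ℕ
    X j = proj₁ (approx j) j
    approx-agrees : ∀ k → AgreeUpTo k (proj₁ (approx k)) X
    approx-agrees zero zero z≤n = refl
    approx-agrees (suc k) t t≤1+k with m≤n⇒m<n∨m≡n t≤1+k
    ... | inj₂ refl = refl
    ... | inj₁ t<1+k = trans (proj₂ (proj₂ (extend (proj₂ (approx k)))) t (≤-pred t<1+k))
                             (approx-agrees k t (≤-pred t<1+k))

outputs-pair-injective : ∀ {n} {e : PR n} {xs} j u j′ u′ →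
                         e [ xs ]⇓ pair j u → e [ xs ]⇓ pair j′ u′ → j ≡ j′ × u ≡ u′
outputs-pair-injective j u j′ u′ e⇓ e⇓′ = pair-injective {j} {u} {j′} {u′} (⇓-deterministic e⇓ e⇓′)

not-query-and-stop : ∀ {n} {e : PR n} {xs} u u′ → e [ xs ]⇓ pair 0 u → ¬ e [ xs ]⇓ pair 1 u′
not-query-and-stop u u′ ask stop with () ← proj₁ (outputs-pair-injective 0 u 1 u′ ask stop)

module _ (m : ℕ) (f : PMF) (A : PR 1)
         (N : Subset (suc m) → List ℕ → Subset (suc (suc m))) where

  private
    F = Error 1 (suc m)
    G = f ∣ᵇ Error 1 (suc (suc m))

  Wins : Subset (suc m) → (ℕ → ℕ) → ℕ → Set
  Wins c x k = WinFrom F G A N c x k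

  Arthur_⇓_ : List ℕ → ℕ → Set
  Arthur h ⇓ move = A [ encode h ∷ [] ]⇓ move

  record UniformRound (x : ℕ → ℕ) (j : ℕ) : Set where
    field
      queried : ℕ
      asks    : Arthur history x j ⇓ pair 0 queried
      legal   : ∀ i → val G queried (N ⁅ i ⁆ (history x j)) (x (suc j))

  UniformPlay : ℕ → (ℕ → ℕ) → Set
  UniformPlay zero x = x 0 ≡ star
  UniformPlay (suc k) x = UniformPlay k x × UniformRound x k

  UniformRound-cong : ∀ {j x y} → AgreeUpTo (suc j) x y → UniformRound x j → UniformRound y j
  UniformRound-cong {j} {x} {y} agree record { queried = u ; asks = asks ; legal = legal } = record
    { queried = u
    ; asks    = subst (Arthur_⇓ pair 0 u) same-history asks
    ; legal   = λ i → subst₂ (val G u) (cong (N ⁅ i ⁆) same-history) (agree (suc j) ≤-refl)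
                             (legal i)
    }
    where
    same-history : history x j ≡ history y j
    same-history = history-cong (λ t t≤j → agree t (m≤n⇒m≤1+n t≤j))

  UniformPlay-cong : ∀ {k x y} → AgreeUpTo k x y → UniformPlay k x → UniformPlay k y
  UniformPlay-cong {zero} agree x₀≡∗ = trans (sym (agree 0 z≤n)) x₀≡∗
  UniformPlay-cong {suc k} agree (uniform , round) =
    UniformPlay-cong (λ t t≤k → agree t (m≤n⇒m≤1+n t≤k)) uniform , UniformRound-cong agree round

  terminal-output-legal : ∀ {c x k} u → Wins c x k → Arthur history x k ⇓ pair 1 u →
                          val F (x 0) c u
  terminal-output-legal {c} {x} u′ (terminate u stop legal) stop′ =
    subst (val F (x 0) c) (proj₂ (outputs-pair-injective 1 u 1 u′ stop stop′)) legal
  terminal-output-legal u′ (query u ask _ _ _) stop =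
    contradiction stop (not-query-and-stop u u′ ask)

  queried-input-legal : ∀ {c x k} u → Wins c x k → Arthur history x k ⇓ pair 0 u →
                        dom G u (N c (history x k))
  queried-input-legal u′ (terminate u stop _) ask = contradiction stop (not-query-and-stop u′ u ask)
  queried-input-legal {c} {x} {k} u′ (query u ask _ legal _) ask′ =
    subst (λ u → dom G u (N c (history x k)))
          (proj₂ (outputs-pair-injective 0 u 0 u′ ask ask′)) legal

  -- An answer u is illegal against the secret ⁅ i ⁆ with toℕ i ≡ u.
  cannot-terminate : ∀ {x k} u → (∀ i → Wins ⁅ i ⁆ x k) → ¬ Arthur history x k ⇓ pair 1 u
  cannot-terminate u wins stop
    with i , i≡u , _ ← terminal-output-legal u (wins fzero) stop
    with i′ , i′≡u , i′∉⁅i⁆ ← terminal-output-legal u (wins i) stop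
    = i′∉⁅i⁆ (subst (_∈ ⁅ i ⁆) (Fin.toℕ-injective (trans i≡u (sym i′≡u))) (x∈⁅x⁆ i))

  UniformRound-reply-legal : ∀ {x j} u → UniformRound x j → Arthur history x j ⇓ pair 0 u →
                             ∀ i → val G u (N ⁅ i ⁆ (history x j)) (x (suc j))
  UniformRound-reply-legal {x} {j} u′ record { queried = u ; asks = asks ; legal = legal } ask′ i =
    subst (λ u → val G u (N ⁅ i ⁆ (history x j)) (x (suc j)))
          (proj₂ (outputs-pair-injective 0 u 0 u′ asks ask′)) (legal i)

  survives-round : ∀ {i x j} → UniformRound x j → Wins ⁅ i ⁆ x j → Wins ⁅ i ⁆ x (suc j)
  survives-round round (terminate u stop _) =
    contradiction stop (not-query-and-stop (UniformRound.queried round) u (UniformRound.asks round))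
  survives-round {i} round (query u ask _ _ (inj₁ illegal)) =
    contradiction (UniformRound-reply-legal u round ask i) illegal
  survives-round _ (query _ _ _ _ (inj₂ wins)) = wins

  never-wins : ∀ {i x k} → (∀ k → UniformPlay k x) → ¬ Wins ⁅ i ⁆ x k
  never-wins {k = k} uniform (terminate u stop _) =
    not-query-and-stop (UniformRound.queried round) u (UniformRound.asks round) stop
    where round = proj₂ (uniform (suc k))
  never-wins {i} {k = k} uniform (query u ask _ _ (inj₁ illegal)) =
    illegal (UniformRound-reply-legal u (proj₂ (uniform (suc k))) ask i)
  never-wins uniform (query _ _ _ _ (inj₂ wins)) = never-wins uniform wins

  module _ (win : ∀ c x → Game.Win F G A N c x) where

    survives : ∀ {k x} → UniformPlay k x → ∀ i → Wins ⁅ i ⁆ x k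
    survives {zero} {x} x₀≡∗ i with win ⁅ i ⁆ x
    ... | inj₁ outside-domain = contradiction (x₀≡∗ , ∣⁅x⁆∣≡1 i) outside-domain
    ... | inj₂ wins = wins
    survives {suc k} (uniform , round) i = survives-round round (survives uniform i)

    uniform-reply : ∀ {k x} → UniformPlay k x → ∃ λ v → UniformRound (followedBy x k v) k
    uniform-reply {k} {x} uniform with survives uniform fzero
    ... | terminate u stop _ = contradiction stop (cannot-terminate u (survives uniform))
    ... | query u ask _ ((a , a∈fu) , _) _ = pair a (toℕ b) , record
      { queried = u
      ; asks    = subst (Arthur_⇓ pair 0 u) (sym same-history) ask
      ; legal   = λ i → a , toℕ b , followedBy-suc x k (pair a (toℕ b)) , a∈fu , b , refl ,
                        subst (λ h → b ∉ N ⁅ i ⁆ h) (sym same-history) (b-free i)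
      }
      where
      secret-singleton : ∀ i → ∣ N ⁅ i ⁆ (history x k) ∣ ≡ 1
      secret-singleton i = proj₂ (proj₂ (queried-input-legal u (survives uniform i) ask))
      b : Fin (suc (suc m))
      b = proj₁ (∃-∉-singletons (suc m) (λ i → N ⁅ i ⁆ (history x k)) secret-singleton)
      b-free : ∀ i → b ∉ N ⁅ i ⁆ (history x k)
      b-free = proj₂ (∃-∉-singletons (suc m) (λ i → N ⁅ i ⁆ (history x k)) secret-singleton)
      same-history : history (followedBy x k (pair a (toℕ b))) k ≡ history x k
      same-history = history-cong (followedBy-agrees x k (pair a (toℕ b)))

    extend-uniform : ∀ {k x} → UniformPlay k x →
                     ∃ λ x′ → UniformPlay (suc k) x′ × AgreeUpTo k x′ x
    extend-uniform {k} {x} uniform with v , round ← uniform-reply uniform =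
      followedBy x k v ,
      (UniformPlay-cong (λ t t≤k → sym (followedBy-agrees x k v t t≤k)) uniform , round) ,
      followedBy-agrees x k v

Error1-not-≤LT : ∀ m f → ¬ (Error 1 (suc m) ≤LT (f ∣ᵇ Error 1 (suc (suc m))))
Error1-not-≤LT m f (A , N , win)
  with X , uniform ← prefix-limit (UniformPlay m f A N) (UniformPlay-cong m f A N)
                                  ((λ _ → 0) , refl) (extend-uniform m f A N win)
  = never-wins m f A N {fzero} uniform (survives m f A N win (uniform 0) fzero)

mainTheorem11 : ∀ (ℓ : ℕ) → 2 ≤ ℓ → ∀ (f : PMF) →
    ¬ (Error 1 ℓ ≤LT (f ∣ᵇ Error 1 (suc ℓ)))
mainTheorem11 zero ()
mainTheorem11 (suc ℓ) _ = Error1-not-≤LT ℓ
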